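{- Let $k \ge 3$ be an integer and let $D$ be a $k$-partite tournament. Then the niche graph $\mathcal{N}(D)$ has at most three connected components.
   Context: A $k$-partite tournament is an orientation of a complete $k$-partite graph with $k$ nonempty partite sets. The niche graph $\mathcal{N}(D)$ of a digraph $D$ has vertex set $V(D)$, and two distinct vertices $u,v$ are adjacent iff they have a common out-neighbor in $D$ or a common in-neighbor in $D$. -}

module Defs where

open import Data.Nat using (ℕ)
open import Data.Fin using (Fin)
open import Data.Product using (Σ; ∃; _×_)
open import Data.Sum using (_⊎_)
open import Relation.Nullary using (¬_)
open import Relation.Binary.PropositionalEquality using (_≡_; _≢_)
open import Relation.Binary.Construct.Closure.ReflexiveTransitive using (Star)

Digraph : ℕ → Set₁
Digraph n = Fin n → Fin n → Set

record IsMultipartiteTournament (k : ℕ) {n : ℕ} (D : Digraph n) : Set where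
  field
    part       : Fin n → Fin k
    nonempty   : ∀ (i : Fin k) → ∃ λ v → part v ≡ i
    noInside   : ∀ u v → part u ≡ part v → ¬ D u v
    oriented   : ∀ u v → part u ≢ part v → D u v ⊎ D v u
    asymmetric : ∀ u v → ¬ (D u v × D v u)

NicheAdj : ∀ {n} → Digraph n → Fin n → Fin n → Set
NicheAdj D u v = u ≢ v × ∃ λ w → (D u w × D v w) ⊎ (D w u × D w v)

NicheConnected : ∀ {n} → Digraph n → Fin n → Fin n → Set
NicheConnected D = Star (NicheAdj D)

-- N(D) has at most m connected components: there are m vertices
-- (not necessarily distinct) such that every vertex lies in the
-- component of one of them.
AtMostComponents : ∀ {n} → ℕ → Digraph n → Set
AtMostComponents {n} m D =
  Σ (Fin m → Fin n) λ r → ∀ v → ∃ λ i → NicheConnected D v (r i)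

-- Take vertices x, y, z from three different partite sets. Every other
-- vertex is joined by an arc to y or lies in y's partite set, and then is
-- joined by arcs to both x and z; each such arc gives it a common in- or
-- out-neighbour with one of x, y, z. If the triangle xyz is cyclic this
-- already puts every vertex in the component of x, y or z. If it is
-- transitive, x, y, z share a component, and the only vertices not reached
-- from it are the v with z → v → x, which all share the in-neighbour z.
module Submission where

open import Defs
open import Data.Nat using (ℕ; suc; _≥_; s≤s; z≤n)
open import Data.Fin using (Fin; zero; suc; _≟_)
open import Data.Fin.Properties using (any?)
open import Data.Product using (∃; _×_; _,_; proj₁; proj₂)
open import Data.Sum using (_⊎_; inj₁; inj₂; [_,_]′)
open import Data.Empty using (⊥-elim)
open import Function using (_∘_; id)
open import Relation.Nullary using (Dec; yes; no)
open import Relation.Nullary.Decidable using (_×-dec_)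
open import Relation.Binary.PropositionalEquality using (_≡_; _≢_; refl; sym; trans)
open import Relation.Binary.Construct.Closure.ReflexiveTransitive using (ε; _◅◅_; return)

atMostComponents-suc : ∀ {n m} {D : Digraph n} →
  AtMostComponents (suc m) D → AtMostComponents (suc (suc m)) D
atMostComponents-suc (r , reach) = rep , λ v → suc (proj₁ (reach v)) , proj₂ (reach v)
  where
  rep : Fin (suc (suc _)) → Fin _
  rep zero    = r zero
  rep (suc i) = r i

module MultipartiteTournament {k n : ℕ} {D : Digraph n} (T : IsMultipartiteTournament k D) where
  open IsMultipartiteTournament T

  arc⇒part≢ : ∀ {u v} → D u v → part u ≢ part v
  arc⇒part≢ {u} {v} uv same = noInside u v same uv

  compare : ∀ u v → D u v ⊎ D v u ⊎ part u ≡ part v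
  compare u v with part u ≟ part v
  ... | yes same = inj₂ (inj₂ same)
  ... | no differ with oriented u v differ
  ...   | inj₁ uv = inj₁ uv
  ...   | inj₂ vu = inj₂ (inj₁ vu)

  arc? : ∀ u v → Dec (D u v)
  arc? u v with compare u v
  ... | inj₁ uv          = yes uv
  ... | inj₂ (inj₁ vu)   = no λ uv → asymmetric u v (uv , vu)
  ... | inj₂ (inj₂ same) = no (noInside u v same)

  commonOut⇒connected : ∀ {u v w} → D u w → D v w → NicheConnected D u v
  commonOut⇒connected {u} {v} uw vw with u ≟ v
  ... | yes refl = ε
  ... | no u≢v   = return (u≢v , _ , inj₁ (uw , vw))

  commonIn⇒connected : ∀ {u v w} → D w u → D w v → NicheConnected D u v
  commonIn⇒connected {u} {v} wu wv with u ≟ v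
  ... | yes refl = ε
  ... | no u≢v   = return (u≢v , _ , inj₂ (wu , wv))

  arcOrArc : ∀ {v y z} → part v ≡ part y → part y ≢ part z → D v z ⊎ D z v
  arcOrArc {v} {y} {z} v∼y y≁z with compare v z
  ... | inj₁ vz          = inj₁ vz
  ... | inj₂ (inj₁ zv)   = inj₂ zv
  ... | inj₂ (inj₂ v∼z)  = ⊥-elim (y≁z (trans (sym v∼y) v∼z))

  cyclic-reach : ∀ {x y z} → D x y → D y z → D z x → ∀ v →
    NicheConnected D v x ⊎ NicheConnected D v y ⊎ NicheConnected D v z
  cyclic-reach {x} {y} {z} xy yz zx v with compare v y
  ... | inj₁ vy          = inj₁ (commonOut⇒connected vy xy)
  ... | inj₂ (inj₁ yv)   = inj₂ (inj₂ (commonIn⇒connected yv yz))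
  ... | inj₂ (inj₂ v∼y) with arcOrArc v∼y (arc⇒part≢ yz)
  ...   | inj₁ vz = inj₂ (inj₁ (commonOut⇒connected vz yz))
  ...   | inj₂ zv = inj₁ (commonIn⇒connected zv zx)

  cyclic⇒atMost3 : ∀ {x y z} → D x y → D y z → D z x → AtMostComponents 3 D
  cyclic⇒atMost3 {x} {y} {z} xy yz zx = rep , λ v →
    [ (zero ,_) , [ (suc zero ,_) , (suc (suc zero) ,_) ]′ ]′ (cyclic-reach xy yz zx v)
    where
    rep : Fin 3 → Fin n
    rep zero          = x
    rep (suc zero)    = y
    rep (suc (suc _)) = z

  transitive-reach : ∀ {x y z} → D x y → D x z → D y z → ∀ v →
    NicheConnected D v x ⊎ (D z v × D v x)
  transitive-reach {x} {y} {z} xy xz yz v with compare v y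
  ... | inj₁ vy          = inj₁ (commonOut⇒connected vy xy)
  ... | inj₂ (inj₁ yv)   = inj₁ (commonIn⇒connected yv yz ◅◅ z⇝x)
    where
    z⇝x : NicheConnected D z x
    z⇝x = commonIn⇒connected xz xy ◅◅ commonOut⇒connected yz xz
  ... | inj₂ (inj₂ v∼y) with arcOrArc v∼y (arc⇒part≢ yz) | arcOrArc v∼y (arc⇒part≢ xy ∘ sym)
  ...   | inj₁ vz | _       = inj₁ (commonOut⇒connected vz xz)
  ...   | inj₂ zv | inj₁ vx = inj₂ (zv , vx)
  ...   | inj₂ zv | inj₂ xv = inj₁ (commonIn⇒connected xv xy ◅◅ commonOut⇒connected yz xz)

  transitive⇒atMost2 : ∀ {x y z} → D x y → D x z → D y z → AtMostComponents 2 D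
  transitive⇒atMost2 {x} {y} {z} xy xz yz with any? (λ v → arc? z v ×-dec arc? v x)
  ... | yes (b , zb , _) = rep , λ v →
    [ (zero ,_) , (λ (zv , _) → suc zero , commonIn⇒connected zv zb) ]′ (transitive-reach xy xz yz v)
    where
    rep : Fin 2 → Fin n
    rep zero    = x
    rep (suc _) = b
  ... | no noBackArc = (λ _ → x) , λ v →
    zero , [ id , (λ zv×vx → ⊥-elim (noBackArc (v , zv×vx))) ]′ (transitive-reach xy xz yz v)

  triangle⇒atMost3 : ∀ {x y z} → part x ≢ part y → part y ≢ part z → part x ≢ part z →
    AtMostComponents 3 D
  triangle⇒atMost3 {x} {y} {z} x≁y y≁z x≁z
    with oriented x y x≁y | oriented y z y≁z | oriented x z x≁z
  ... | inj₁ xy | inj₁ yz | inj₁ xz = atMostComponents-suc (transitive⇒atMost2 xy xz yz)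
  ... | inj₁ xy | inj₁ yz | inj₂ zx = cyclic⇒atMost3 xy yz zx
  ... | inj₁ xy | inj₂ zy | inj₁ xz = atMostComponents-suc (transitive⇒atMost2 xz xy zy)
  ... | inj₁ xy | inj₂ zy | inj₂ zx = atMostComponents-suc (transitive⇒atMost2 zx zy xy)
  ... | inj₂ yx | inj₁ yz | inj₁ xz = atMostComponents-suc (transitive⇒atMost2 yx yz xz)
  ... | inj₂ yx | inj₁ yz | inj₂ zx = atMostComponents-suc (transitive⇒atMost2 yz yx zx)
  ... | inj₂ yx | inj₂ zy | inj₁ xz = cyclic⇒atMost3 xz zy yx
  ... | inj₂ yx | inj₂ zy | inj₂ zx = atMostComponents-suc (transitive⇒atMost2 zy zx yx)

  member : Fin k → Fin n
  member i = proj₁ (nonempty i)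

  member-part≢ : ∀ {i j} → i ≢ j → part (member i) ≢ part (member j)
  member-part≢ {i} {j} i≢j same = i≢j (trans (sym (proj₂ (nonempty i))) (trans same (proj₂ (nonempty j))))

corollary2p8 : (k n : ℕ) → k ≥ 3 → (D : Digraph n) →
    IsMultipartiteTournament k D → AtMostComponents 3 D
corollary2p8 (suc (suc (suc _))) n (s≤s (s≤s (s≤s z≤n))) D T =
  triangle⇒atMost3 {member zero} {member (suc zero)} {member (suc (suc zero))}
    (member-part≢ λ ()) (member-part≢ λ ()) (member-part≢ λ ())
  where open MultipartiteTournament T
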